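{- Let $\beta, M,\Delta\ge 1$ be reals and $m,k$ positive integers, with $\beta+2<M/4$ and $3\Delta<\beta$. Let $G$ be a graph such that $\overline G$ contains no copy of $K_m^k$ and $|G|\ge \max(m, M(k-1.5)m)$. Then there exist an integer $k'$ and an induced subgraph $H\subseteq G$ such that: $\overline H$ contains no copy of $K_m^{k'}$; $M(k'-1.5)m-m\le |H|\le M(k'-1.5)m$ and $|H|\ge m$; and $H$ $(\Delta,\beta,m)$-expands into $V(H)$.
   Context: $K_m^k$ is the complete $k$-partite graph with $k$ parts of size $m$; $K_m^1$ is a set of $m$ vertices with no edges (so a graph with complement $K_m^1$-free has fewer than $m$ vertices). $\overline G$ is the complement of $G$. For a graph $G$ and a set of vertices $S$, $N_G(S)$ is the set of vertices adjacent to some vertex of $S$, and $N_W(S)=N_G(S)\cap W$. For a graph $G$ and $W\subseteq V(G)$, $G$ $(\Delta,\beta,m)$-expands into $W$ if (i) $|N_W(S)|\ge \Delta|S|$ for all $S\subseteq V(G)$ with $|S|<m$, and (ii) $|N_G(S)\cup S|\ge |S|+\beta m$ for all $S\subseteq V(G)$ with $m\le |S|\le |G|/2$.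
   Formalization: The parameters β, M and Δ range over the rationals instead of the reals. -}

module Defs where

open import Data.Bool using (Bool; true; false; _∧_; _∨_)
open import Data.Nat as ℕ using (ℕ; zero; suc)
open import Data.Integer using (+_)
open import Data.Fin using (Fin)
open import Data.Fin.Subset using (Subset; _∈_; _∩_; _∪_; ∣_∣; inside; outside)
open import Data.Vec using (tabulate; lookup)
open import Data.Product using (Σ; _×_; _,_)
open import Data.Rational as ℚ using (ℚ; _/_)
open import Relation.Binary.PropositionalEquality using (_≡_; _≢_)

ℕ→ℚ : ℕ → ℚ
ℕ→ℚ n = (+ n) / 1

record SimpleGraph (n : ℕ) : Set where
  field
    adj    : Fin n → Fin n → Bool
    sym    : ∀ u v → adj u v ≡ adj v u
    irrefl : ∀ v → adj v v ≡ false
open SimpleGraph public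

anyFin : ∀ {n} → (Fin n → Bool) → Bool
anyFin {zero}  f = false
anyFin {suc n} f = f Fin.zero ∨ anyFin {n} (λ i → f (Fin.suc i))

N : ∀ {n} → SimpleGraph n → Subset n → Subset n
N G S = tabulate λ v → anyFin λ u → isIn (lookup S u) ∧ adj G u v
  where
  isIn : _ → Bool
  isIn inside  = true
  isIn outside = false

-- The complement of the induced subgraph G[W] contains a copy of K_m^k:
-- an injective map f : Fin k × Fin m → W such that vertices in
-- different parts are adjacent in the complement (distinct, non-adjacent in G).
CompContainsK : ∀ {n} → SimpleGraph n → Subset n → (m k : ℕ) → Set
CompContainsK {n} G W m k =
  Σ (Fin k → Fin m → Fin n) λ f →
    (∀ i j → f i j ∈ W) ×
    (∀ i j i' j' → f i j ≡ f i' j' → (i ≡ i') × (j ≡ j')) ×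
    (∀ i j i' j' → i ≢ i' → adj G (f i j) (f i' j') ≡ false)

ExpandsInto : ∀ {n} → SimpleGraph n → Subset n → (Δ β : ℚ) → (m : ℕ) → Set
ExpandsInto {n} G W Δ β m =
  (∀ (S : Subset n) → (∀ {x} → x ∈ S → x ∈ W) → ∣ S ∣ ℕ.< m →
      Δ ℚ.* ℕ→ℚ ∣ S ∣ ℚ.≤ ℕ→ℚ ∣ N G S ∩ W ∣) ×
  (∀ (S : Subset n) → (∀ {x} → x ∈ S → x ∈ W) → m ℕ.≤ ∣ S ∣ → 2 ℕ.* ∣ S ∣ ℕ.≤ ∣ W ∣ →
      ℕ→ℚ ∣ S ∣ ℚ.+ β ℚ.* ℕ→ℚ m ℚ.≤ ℕ→ℚ ∣ (N G S ∩ W) ∪ S ∣)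

{-# OPTIONS --safe #-}
-- Descent on k, measured against L(k) = M(k - 3/2)m.  Given X with complement
-- K_m^a-free and |X| ≥ L(a), take W₀ ⊆ X with |W₀| = ⌊L(a)⌋ and keep peeling off
-- sets S with |S| < m and |N_W(S)| < Δ|S| from the remainder W.  If W expands, it is
-- the required H.  Otherwise some W contains a bottleneck S: m ≤ |S|, 2|S| ≤ |W| and
-- |N_W(S) ∪ S| < |S| + βm (the peeled part itself becomes one as soon as it reaches
-- m vertices, because it has at most 2m vertices and 3Δ < β).  Then S and
-- B = W ∖ (N_W(S) ∪ S) are anticomplete with at least m vertices each, so if j₁, j₂
-- are maximal with K_m^{j₁}, K_m^{j₂} in the complements of S, B, the two copies
-- combine and j₁ + j₂ < a.  As L(j₁+1) + L(j₂+1) + (β+1)m ≤ L(a), one of S, B is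
-- large for the smaller index j₁+1 or j₂+1, and the descent continues there.
module Submission where

open import Defs renaming (sym to adj-sym)
open import Data.Bool as Bool using (Bool; true; false)
open import Data.Empty using (⊥-elim)
open import Data.Fin as Fin using (Fin; splitAt; join; inject≤)
open import Data.Fin.Subset using (Subset; _∈_; _∉_; _⊆_; _∩_; _∪_; _─_; ∣_∣; inside; outside; ⊥; ⊤)
open import Data.Integer as ℤ using (+_)
open import Data.Nat as ℕ using (ℕ; zero; suc; z≤n; s≤s; _+_)
open import Data.Nat.Induction using (<-rec)
open import Data.Product using (Σ; ∃; _×_; _,_; proj₁; proj₂)
open import Data.Rational as ℚ using (ℚ; _/_; 1ℚ; 0ℚ; mkℚ; ½)
open import Data.Rational.Solver using (module +-*-Solver)
open import Data.Sum as Sum using (_⊎_; inj₁; inj₂; [_,_]′)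
open import Data.Vec as Vec using (Vec; []; _∷_; lookup; tabulate; here; there)
open import Data.Vec.Properties using (lookup∘tabulate; []=⇒lookup; lookup⇒[]=)
open import Function using (id; _∘_; _∘′_)
open import Relation.Binary.PropositionalEquality
open import Relation.Nullary using (¬_; Dec; yes; no)
open import Relation.Nullary.Decidable using (_×-dec_; _→-dec_; ¬?; map′)
open import Relation.Unary using (Decidable)
import Data.Fin.Properties as FinP
import Data.Fin.Subset.Properties as SubsetP
import Data.Integer.Properties as ℤP
import Data.Nat.Coprimality as Coprime
import Data.Nat.Properties as ℕP
import Data.Rational.Properties as ℚP
open +-*-Solver

ℕ→ℚ≡mkℚ : ∀ n → ℕ→ℚ n ≡ mkℚ (+ n) 0 (Coprime.sym (Coprime.1-coprimeTo n))
ℕ→ℚ≡mkℚ n = ℚP.normalize-coprime (Coprime.sym (Coprime.1-coprimeTo n))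

private
  n*1≡n : ∀ n → + n ℤ.* + 1 ≡ + n
  n*1≡n n = ℤP.*-identityʳ (+ n)

ℕ→ℚ-mono-≤ : ∀ {a b} → a ℕ.≤ b → ℕ→ℚ a ℚ.≤ ℕ→ℚ b
ℕ→ℚ-mono-≤ {a} {b} a≤b rewrite ℕ→ℚ≡mkℚ a | ℕ→ℚ≡mkℚ b =
  ℚ.*≤* (subst₂ ℤ._≤_ (sym (n*1≡n a)) (sym (n*1≡n b)) (ℤ.+≤+ a≤b))

ℕ→ℚ-mono-< : ∀ {a b} → a ℕ.< b → ℕ→ℚ a ℚ.< ℕ→ℚ b
ℕ→ℚ-mono-< {a} {b} a<b rewrite ℕ→ℚ≡mkℚ a | ℕ→ℚ≡mkℚ b =
  ℚ.*<* (subst₂ ℤ._<_ (sym (n*1≡n a)) (sym (n*1≡n b)) (ℤ.+<+ a<b))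

ℕ→ℚ-cancel-< : ∀ {a b} → ℕ→ℚ a ℚ.< ℕ→ℚ b → a ℕ.< b
ℕ→ℚ-cancel-< {a} {b} a<b rewrite ℕ→ℚ≡mkℚ a | ℕ→ℚ≡mkℚ b with a<b
... | ℚ.*<* a<b′ = ℤP.drop‿+<+ (subst₂ ℤ._<_ (n*1≡n a) (n*1≡n b) a<b′)

ℕ→ℚ-+ : ∀ a b → ℕ→ℚ (a + b) ≡ ℕ→ℚ a ℚ.+ ℕ→ℚ b
ℕ→ℚ-+ a b = trans (cong (_/ 1) (trans (ℤP.pos-+ a b) (sym (cong₂ ℤ._+_ (n*1≡n a) (n*1≡n b)))))
  (sym (cong₂ ℚ._+_ (ℕ→ℚ≡mkℚ a) (ℕ→ℚ≡mkℚ b)))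

ℕ→ℚ-* : ∀ a b → ℕ→ℚ (a ℕ.* b) ≡ ℕ→ℚ a ℚ.* ℕ→ℚ b
ℕ→ℚ-* a b = trans (cong (_/ 1) (ℤP.pos-* a b)) (sym (cong₂ ℚ._*_ (ℕ→ℚ≡mkℚ a) (ℕ→ℚ≡mkℚ b)))

0≤ℕ→ℚ : ∀ n → 0ℚ ℚ.≤ ℕ→ℚ n
0≤ℕ→ℚ n = ℕ→ℚ-mono-≤ {0} {n} z≤n

-- Linear inequalities over ℚ are proved by exhibiting y as x plus a sum of
-- products of slacks of the hypotheses; the ring solver checks that identity.
≤-via : ∀ {x y d} → 0ℚ ℚ.≤ d → x ℚ.+ d ≡ y → x ℚ.≤ y
≤-via {x} {d = d} 0≤d refl = subst (ℚ._≤ x ℚ.+ d) (ℚP.+-identityʳ x) (ℚP.+-monoʳ-≤ x 0≤d)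

<-via : ∀ {x y d} → 0ℚ ℚ.< d → x ℚ.+ d ≡ y → x ℚ.< y
<-via {x} {d = d} 0<d refl = subst (ℚ._< x ℚ.+ d) (ℚP.+-identityʳ x) (ℚP.+-monoʳ-< x 0<d)

slack-≤ : ∀ {x y} → x ℚ.≤ y → 0ℚ ℚ.≤ y ℚ.- x
slack-≤ {x} {y} x≤y = subst (ℚ._≤ y ℚ.- x) (ℚP.+-inverseʳ x) (ℚP.+-monoˡ-≤ (ℚ.- x) x≤y)

slack-< : ∀ {x y} → x ℚ.< y → 0ℚ ℚ.< y ℚ.- x
slack-< {x} {y} x<y = subst (ℚ._< y ℚ.- x) (ℚP.+-inverseʳ x) (ℚP.+-monoˡ-< (ℚ.- x) x<y)

0≤* : ∀ {p q} → 0ℚ ℚ.≤ p → 0ℚ ℚ.≤ q → 0ℚ ℚ.≤ p ℚ.* q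
0≤* {p} {q} 0≤p 0≤q = ℚP.nonNegative⁻¹ (p ℚ.* q)
  {{ℚP.nonNeg*nonNeg⇒nonNeg p {{ℚ.nonNegative 0≤p}} q {{ℚ.nonNegative 0≤q}}}}

0<½* : ∀ {p} → 0ℚ ℚ.< p → 0ℚ ℚ.< ½ ℚ.* p
0<½* {p} 0<p = ℚP.positive⁻¹ (½ ℚ.* p) {{ℚP.pos*pos⇒pos ½ p {{ℚ.positive 0<p}}}}

+-≤-split : ∀ {x y s b} → x ℚ.+ y ℚ.< s ℚ.+ b → x ℚ.≤ s ⊎ y ℚ.≤ b
+-≤-split {x} {y} {s} {b} x+y<s+b with x ℚP.≤? s
... | yes x≤s = inj₁ x≤s
... | no x≰s = inj₂ (ℚP.<⇒≤ (<-via (ℚP.+-mono-<-≤ (slack-< x+y<s+b) (ℚP.<⇒≤ (slack-< (ℚP.≰⇒> x≰s))))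
  (solve 4 (λ x y s b → y :+ ((s :+ b :- (x :+ y)) :+ (x :- s)) := b) refl x y s b)))

∃-floor : ∀ t {x} → 0ℚ ℚ.≤ x → x ℚ.≤ ℕ→ℚ t →
          Σ ℕ λ c → c ℕ.≤ t × ℕ→ℚ c ℚ.≤ x × x ℚ.< ℕ→ℚ (suc c)
∃-floor zero 0≤x x≤0 = 0 , z≤n , 0≤x , ℚP.≤-<-trans x≤0 (ℕ→ℚ-mono-< {0} {1} ℕP.≤-refl)
∃-floor (suc t) {x} 0≤x x≤t+1 = step (x ℚP.≤? ℕ→ℚ t) (x ℚP.<? ℕ→ℚ (suc t))
  where
  step : Dec (x ℚ.≤ ℕ→ℚ t) → Dec (x ℚ.< ℕ→ℚ (suc t)) →
         Σ ℕ λ c → c ℕ.≤ suc t × ℕ→ℚ c ℚ.≤ x × x ℚ.< ℕ→ℚ (suc c)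
  step (yes x≤t) _ = let c , c≤t , rest = ∃-floor t 0≤x x≤t in c , ℕP.m≤n⇒m≤1+n c≤t , rest
  step (no x≰t) (yes x<t+1) = t , ℕP.n≤1+n t , ℚP.<⇒≤ (ℚP.≰⇒> x≰t) , x<t+1
  step (no _) (no x≮t+1) =
    suc t , ℕP.≤-refl , ℚP.≮⇒≥ x≮t+1 , ℚP.≤-<-trans x≤t+1 (ℕ→ℚ-mono-< {suc t} {suc (suc t)} ℕP.≤-refl)

expansion-accumulates : ∀ Δ {a s u v w} → w ℚ.≤ u ℚ.+ v ℚ.+ s → u ℚ.≤ a ℚ.+ Δ ℚ.* a → v ℚ.< Δ ℚ.* s →
                        w ℚ.< (a ℚ.+ s) ℚ.+ Δ ℚ.* (a ℚ.+ s)
expansion-accumulates Δ {a} {s} {u} {v} {w} w≤ u≤ v< =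
  <-via (ℚP.+-mono-<-≤ (slack-< v<) (ℚP.+-mono-≤ (slack-≤ w≤) (slack-≤ u≤)))
    (solve 6 (λ Δ a s u v w → w :+ ((Δ :* s :- v) :+ ((u :+ v :+ s :- w) :+ (a :+ Δ :* a :- u)))
       := (a :+ s) :+ Δ :* (a :+ s)) refl Δ a s u v w)

x<y+z⇒x-z≤y : ∀ {x y z} → x ℚ.< y ℚ.+ z → x ℚ.- z ℚ.≤ y
x<y+z⇒x-z≤y {x} {y} {z} x<y+z = ≤-via (ℚP.<⇒≤ (slack-< x<y+z))
  (solve 3 (λ x y z → (x :- z) :+ ((y :+ z) :- x) := y) refl x y z)

expansion-within-margin : ∀ {Δ β m x w} → 0ℚ ℚ.≤ Δ → 0ℚ ℚ.≤ m → ℕ→ℚ 3 ℚ.* Δ ℚ.< β →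
                          x ℚ.≤ m ℚ.+ m → w ℚ.< x ℚ.+ Δ ℚ.* x → w ℚ.< x ℚ.+ β ℚ.* m
expansion-within-margin {Δ} {β} {m} {x} {w} 0≤Δ 0≤m 3Δ<β x≤2m w< = <-via
  (ℚP.+-mono-<-≤ (slack-< w<) (ℚP.+-mono-≤ (0≤* 0≤Δ (slack-≤ x≤2m))
    (ℚP.+-mono-≤ (0≤* (ℚP.<⇒≤ (slack-< 3Δ<β)) 0≤m) (0≤* 0≤Δ 0≤m))))
  (solve 5 (λ Δ β m x w →
       w :+ ((x :+ Δ :* x :- w) :+ (Δ :* (m :+ m :- x) :+ ((β :- con (ℕ→ℚ 3) :* Δ) :* m :+ Δ :* m)))
     := x :+ β :* m) refl Δ β m x w)

module Bounds (β M : ℚ) (m : ℕ) (1≤β : 1ℚ ℚ.≤ β) (1≤M : 1ℚ ℚ.≤ M)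
              (β+2<M/4 : β ℚ.+ ℕ→ℚ 2 ℚ.< M ℚ.* ((+ 1) / 4)) where

  L : ℕ → ℚ
  L a = M ℚ.* (ℕ→ℚ a ℚ.- (+ 3) / 2) ℚ.* ℕ→ℚ m

  private
    m̂ : ℚ
    m̂ = ℕ→ℚ m
    0≤m̂ : 0ℚ ℚ.≤ m̂
    0≤m̂ = 0≤ℕ→ℚ m
    0≤M : 0ℚ ℚ.≤ M
    0≤M = ℚP.≤-trans (0≤ℕ→ℚ 1) 1≤M
    0≤β-1 : 0ℚ ℚ.≤ β ℚ.- 1ℚ
    0≤β-1 = slack-≤ 1≤β
    0≤gap : 0ℚ ℚ.≤ M ℚ.* ((+ 1) / 4) ℚ.- (β ℚ.+ ℕ→ℚ 2)
    0≤gap = ℚP.<⇒≤ (slack-< β+2<M/4)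

  L-large : ∀ {a} → 2 ℕ.≤ a → (β ℚ.+ β ℚ.+ ℕ→ℚ 4) ℚ.* m̂ ℚ.≤ L a
  L-large {a} 2≤a = ≤-via
    (ℚP.+-mono-≤ (0≤* (0≤* 0≤M (slack-≤ (ℕ→ℚ-mono-≤ 2≤a))) 0≤m̂) (0≤* (0≤* (0≤ℕ→ℚ 2) 0≤gap) 0≤m̂))
    (solve 4 (λ M β a m → (β :+ β :+ con (ℕ→ℚ 4)) :* m
       :+ (M :* (a :- con (ℕ→ℚ 2)) :* m :+ con (ℕ→ℚ 2) :* (M :* con ((+ 1) / 4) :- (β :+ con (ℕ→ℚ 2))) :* m)
       := M :* (a :- con ((+ 3) / 2)) :* m) refl M β (ℕ→ℚ a) m̂)

  0≤L : ∀ {a} → 2 ℕ.≤ a → 0ℚ ℚ.≤ L a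
  0≤L {a} 2≤a = ℚP.≤-trans (0≤* (ℚP.+-mono-≤ (ℚP.+-mono-≤ 0≤β 0≤β) (0≤ℕ→ℚ 4)) 0≤m̂) (L-large {a} 2≤a)
    where
    0≤β : 0ℚ ℚ.≤ β
    0≤β = ℚP.≤-trans (0≤ℕ→ℚ 1) 1≤β

  L-superadditive : ∀ {a a₁ a₂} → a₁ + a₂ ℕ.≤ a + 1 → L a₁ ℚ.+ L a₂ ℚ.+ (β ℚ.+ 1ℚ) ℚ.* m̂ ℚ.≤ L a
  L-superadditive {a} {a₁} {a₂} a₁+a₂≤a+1 = ≤-via
    (ℚP.+-mono-≤ (0≤* (0≤* 0≤M (slack-≤ sum≤)) 0≤m̂)
                 (0≤* (ℚP.+-mono-≤ (ℚP.+-mono-≤ (0≤* (0≤ℕ→ℚ 2) 0≤gap) 0≤β-1) (0≤ℕ→ℚ 4)) 0≤m̂))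
    (solve 6 (λ M β a a₁ a₂ m →
         M :* (a₁ :- con h) :* m :+ M :* (a₂ :- con h) :* m :+ (β :+ con 1ℚ) :* m
         :+ (M :* ((a :+ con (ℕ→ℚ 1)) :- (a₁ :+ a₂)) :* m
             :+ (con (ℕ→ℚ 2) :* (M :* con ((+ 1) / 4) :- (β :+ con (ℕ→ℚ 2))) :+ (β :- con 1ℚ) :+ con (ℕ→ℚ 4)) :* m)
       := M :* (a :- con h) :* m) refl M β (ℕ→ℚ a) (ℕ→ℚ a₁) (ℕ→ℚ a₂) m̂)
    where
    h : ℚ
    h = (+ 3) / 2
    sum≤ : ℕ→ℚ a₁ ℚ.+ ℕ→ℚ a₂ ℚ.≤ ℕ→ℚ a ℚ.+ ℕ→ℚ 1
    sum≤ = subst₂ ℚ._≤_ (ℕ→ℚ-+ a₁ a₂) (ℕ→ℚ-+ a 1) (ℕ→ℚ-mono-≤ a₁+a₂≤a+1)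

  L-split : ∀ {a a₁ a₂ s b u} → a₁ + a₂ ℕ.≤ a + 1 → L a ℚ.< (b ℚ.+ u) ℚ.+ m̂ → u ℚ.< s ℚ.+ β ℚ.* m̂ →
            L a₁ ℚ.≤ s ⊎ L a₂ ℚ.≤ b
  L-split {a} {a₁} {a₂} {s} {b} {u} gap La< u< = +-≤-split (<-via
    (ℚP.+-mono-<-≤ (slack-< La<) (ℚP.+-mono-≤ (slack-≤ (L-superadditive {a} {a₁} {a₂} gap)) (ℚP.<⇒≤ (slack-< u<))))
    (solve 8 (λ x y z β m s b u →
         (x :+ y) :+ (((b :+ u) :+ m :- z) :+ ((z :- (x :+ y :+ (β :+ con 1ℚ) :* m)) :+ (s :+ β :* m :- u)))
       := s :+ b) refl (L a₁) (L a₂) (L a) β m̂ s b u))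

  bottleneck-complement-large : ∀ {a s b u} → 2 ℕ.≤ a → L a ℚ.< (b ℚ.+ u) ℚ.+ m̂ →
                                ℕ→ℚ 2 ℚ.* s ℚ.≤ b ℚ.+ u → u ℚ.< s ℚ.+ β ℚ.* m̂ → m̂ ℚ.< b
  bottleneck-complement-large {a} {s} {b} {u} 2≤a La< 2s≤ u< = <-via
    (0<½* (ℚP.+-mono-<-≤ (ℚP.+-mono-< (slack-< u<) (slack-< u<))
      (ℚP.+-mono-≤ (slack-≤ 2s≤)
        (ℚP.+-mono-≤ (ℚP.<⇒≤ (slack-< La<)) (ℚP.+-mono-≤ (slack-≤ (L-large {a} 2≤a)) 0≤m̂)))))
    (solve 6 (λ z β m s b u →
         m :+ con ½ :* (((s :+ β :* m :- u) :+ (s :+ β :* m :- u))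
           :+ ((b :+ u :- con (ℕ→ℚ 2) :* s)
               :+ (((b :+ u) :+ m :- z) :+ ((z :- (β :+ β :+ con (ℕ→ℚ 4)) :* m) :+ m))))
       := b) refl (L a) β m̂ s b u)

  L<w+m⇒m<w : ∀ {a w} → 2 ℕ.≤ a → L a ℚ.< w ℚ.+ m̂ → m̂ ℚ.< w
  L<w+m⇒m<w {a} {w} 2≤a La< = <-via
    (ℚP.+-mono-<-≤ (slack-< La<) (ℚP.+-mono-≤ (slack-≤ (L-large {a} 2≤a))
      (0≤* (ℚP.+-mono-≤ (0≤* (0≤ℕ→ℚ 2) 0≤β-1) (0≤ℕ→ℚ 4)) 0≤m̂)))
    (solve 4 (λ z β m w →
         m :+ ((w :+ m :- z) :+ ((z :- (β :+ β :+ con (ℕ→ℚ 4)) :* m)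
                                 :+ (con (ℕ→ℚ 2) :* (β :- con 1ℚ) :+ con (ℕ→ℚ 4)) :* m))
       := w) refl (L a) β m̂ w)

  L<c⇒2[m+m]<c : ∀ {a c} → 2 ℕ.≤ a → L a ℚ.< ℕ→ℚ c → 2 ℕ.* (m + m) ℕ.< c
  L<c⇒2[m+m]<c {a} {c} 2≤a La< = ℕ→ℚ-cancel-< (subst (ℚ._< ℕ→ℚ c)
    (sym (trans (ℕ→ℚ-* 2 (m + m)) (cong (ℕ→ℚ 2 ℚ.*_) (ℕ→ℚ-+ m m))))
    (<-via (ℚP.+-mono-<-≤ (slack-< La<) (ℚP.+-mono-≤ (slack-≤ (L-large {a} 2≤a))
      (0≤* (ℚP.+-mono-≤ (0≤* (0≤ℕ→ℚ 2) 0≤β-1) (0≤ℕ→ℚ 2)) 0≤m̂)))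
    (solve 4 (λ z β m c →
         con (ℕ→ℚ 2) :* (m :+ m) :+ ((c :- z) :+ ((z :- (β :+ β :+ con (ℕ→ℚ 4)) :* m)
                                                :+ (con (ℕ→ℚ 2) :* (β :- con 1ℚ) :+ con (ℕ→ℚ 2)) :* m))
       := c) refl (L a) β m̂ (ℕ→ℚ c))))

∃-boundary : ∀ {P : ℕ → Set} → Decidable P → ∀ i d → P i → ¬ P (i + d) →
             Σ ℕ λ j → i ℕ.≤ j × P j × ¬ P (suc j)
∃-boundary {P} P? i zero Pi ¬Pi+0 = ⊥-elim (¬Pi+0 (subst P (sym (ℕP.+-identityʳ i)) Pi))
∃-boundary {P} P? i (suc d) Pi ¬Pi+d+1 with P? (suc i)
... | no ¬Pi+1 = i , ℕP.≤-refl , Pi , ¬Pi+1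
... | yes Pi+1 =
  let j , i+1≤j , Pj , ¬Pj+1 = ∃-boundary P? (suc i) d Pi+1 (subst (¬_ ∘′ P) (ℕP.+-suc i d) ¬Pi+d+1)
  in j , ℕP.<⇒≤ i+1≤j , Pj , ¬Pj+1

Searchable : Set → Set₁
Searchable A = ∀ {P : A → Set} → Decidable P → Dec (∃ P)

Vec-searchable : ∀ {A} → Searchable A → ∀ k → Searchable (Vec A k)
Vec-searchable search zero P? = map′ (λ p → [] , p) (λ { ([] , p) → p }) (P? [])
Vec-searchable search (suc k) P? =
  map′ (λ { (x , xs , p) → x ∷ xs , p }) (λ { (x ∷ xs , p) → x , xs , p })
    (search (λ x → Vec-searchable search k (λ xs → P? (x ∷ xs))))

private variable
  n : ℕ

x∈p─q⇒x∉q : ∀ {p q : Subset n} {x} → x ∈ p ─ q → x ∉ q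
x∈p─q⇒x∉q {p = s ∷ p} {q = outside ∷ q} here = λ ()
x∈p─q⇒x∉q {p = s ∷ p} {q = t ∷ q} (there x∈p─q) (there x∈q) = x∈p─q⇒x∉q x∈p─q x∈q

∪-⊆ : ∀ {p q r : Subset n} → p ⊆ r → q ⊆ r → p ∪ q ⊆ r
∪-⊆ {p = p} {q = q} p⊆r q⊆r x∈p∪q = [ p⊆r , q⊆r ]′ (SubsetP.x∈p∪q⁻ p q x∈p∪q)

∣p─q∣+∣q∣≡∣p∣ : ∀ {p q : Subset n} → q ⊆ p → ∣ p ─ q ∣ + ∣ q ∣ ≡ ∣ p ∣
∣p─q∣+∣q∣≡∣p∣ {p = []} {q = []} _ = refl
∣p─q∣+∣q∣≡∣p∣ {p = inside ∷ p} {q = outside ∷ q} q⊆p = cong suc (∣p─q∣+∣q∣≡∣p∣ (SubsetP.drop-∷-⊆ q⊆p))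
∣p─q∣+∣q∣≡∣p∣ {p = outside ∷ p} {q = outside ∷ q} q⊆p = ∣p─q∣+∣q∣≡∣p∣ (SubsetP.drop-∷-⊆ q⊆p)
∣p─q∣+∣q∣≡∣p∣ {p = inside ∷ p} {q = inside ∷ q} q⊆p =
  trans (ℕP.+-suc _ _) (cong suc (∣p─q∣+∣q∣≡∣p∣ (SubsetP.drop-∷-⊆ q⊆p)))
∣p─q∣+∣q∣≡∣p∣ {p = outside ∷ p} {q = inside ∷ q} q⊆p with q⊆p here
... | ()

∣p∪q∣≤∣p∣+∣q∣ : ∀ (p q : Subset n) → ∣ p ∪ q ∣ ℕ.≤ ∣ p ∣ + ∣ q ∣
∣p∪q∣≤∣p∣+∣q∣ [] [] = z≤n
∣p∪q∣≤∣p∣+∣q∣ (inside ∷ p) (t ∷ q) =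
  s≤s (ℕP.≤-trans (∣p∪q∣≤∣p∣+∣q∣ p q) (ℕP.+-monoʳ-≤ ∣ p ∣ (SubsetP.∣p∣≤∣x∷p∣ t q)))
∣p∪q∣≤∣p∣+∣q∣ (outside ∷ p) (inside ∷ q) =
  ℕP.≤-trans (s≤s (∣p∪q∣≤∣p∣+∣q∣ p q)) (ℕP.≤-reflexive (sym (ℕP.+-suc _ _)))
∣p∪q∣≤∣p∣+∣q∣ (outside ∷ p) (outside ∷ q) = ∣p∪q∣≤∣p∣+∣q∣ p q

∣p∪q∣≡∣p∣+∣q∣ : ∀ (p q : Subset n) → (∀ {x} → x ∈ p → x ∉ q) → ∣ p ∪ q ∣ ≡ ∣ p ∣ + ∣ q ∣
∣p∪q∣≡∣p∣+∣q∣ [] [] _ = refl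
∣p∪q∣≡∣p∣+∣q∣ (inside ∷ p) (inside ∷ q) disj = ⊥-elim (disj here here)
∣p∪q∣≡∣p∣+∣q∣ (inside ∷ p) (outside ∷ q) disj =
  cong suc (∣p∪q∣≡∣p∣+∣q∣ p q (λ x∈p x∈q → disj (there x∈p) (there x∈q)))
∣p∪q∣≡∣p∣+∣q∣ (outside ∷ p) (inside ∷ q) disj =
  trans (cong suc (∣p∪q∣≡∣p∣+∣q∣ p q (λ x∈p x∈q → disj (there x∈p) (there x∈q)))) (sym (ℕP.+-suc _ _))
∣p∪q∣≡∣p∣+∣q∣ (outside ∷ p) (outside ∷ q) disj = ∣p∪q∣≡∣p∣+∣q∣ p q (λ x∈p x∈q → disj (there x∈p) (there x∈q))

∃-⊆-of-size : (p : Subset n) (c : ℕ) → c ℕ.≤ ∣ p ∣ → Σ (Subset n) λ q → q ⊆ p × ∣ q ∣ ≡ c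
∃-⊆-of-size [] zero _ = [] , (λ x∈[] → x∈[]) , refl
∃-⊆-of-size (inside ∷ p) zero _ =
  let q , q⊆p , ∣q∣≡0 = ∃-⊆-of-size p zero z≤n in outside ∷ q , SubsetP.out⊆ q⊆p , ∣q∣≡0
∃-⊆-of-size (inside ∷ p) (suc c) (s≤s c≤∣p∣) =
  let q , q⊆p , ∣q∣≡c = ∃-⊆-of-size p c c≤∣p∣ in inside ∷ q , SubsetP.s⊆s q⊆p , cong suc ∣q∣≡c
∃-⊆-of-size (outside ∷ p) c c≤∣p∣ =
  let q , q⊆p , ∣q∣≡c = ∃-⊆-of-size p c c≤∣p∣ in outside ∷ q , SubsetP.out⊆ q⊆p , ∣q∣≡c

enumerate : (p : Subset n) →
            Σ (Fin ∣ p ∣ → Fin n) λ e → (∀ i → e i ∈ p) × (∀ i j → e i ≡ e j → i ≡ j)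
enumerate [] = (λ ()) , (λ ()) , (λ ())
enumerate (outside ∷ p) =
  let e , e∈p , e-inj = enumerate p
  in Fin.suc ∘ e , there ∘ e∈p , λ i j eq → e-inj i j (FinP.suc-injective eq)
enumerate {n = suc n} (inside ∷ p) with enumerate p
... | e , e∈p , e-inj = e′ , e′∈ , e′-inj
  where
  e′ : Fin (suc ∣ p ∣) → Fin (suc n)
  e′ Fin.zero = Fin.zero
  e′ (Fin.suc i) = Fin.suc (e i)
  e′∈ : ∀ i → e′ i ∈ inside ∷ p
  e′∈ Fin.zero = here
  e′∈ (Fin.suc i) = there (e∈p i)
  e′-inj : ∀ i j → e′ i ≡ e′ j → i ≡ j
  e′-inj Fin.zero Fin.zero _ = refl
  e′-inj (Fin.suc i) (Fin.suc j) eq = cong Fin.suc (e-inj i j (FinP.suc-injective eq))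

anyFin⁻ : ∀ {k} (f : Fin k → Bool) → anyFin f ≡ true → Σ (Fin k) λ i → f i ≡ true
anyFin⁻ {suc k} f any≡true with f Fin.zero in f0≡b
... | true = Fin.zero , f0≡b
... | false = let i , fi≡true = anyFin⁻ (f ∘ Fin.suc) any≡true in Fin.suc i , fi≡true

anyFin≡false : ∀ {k} (f : Fin k → Bool) → anyFin f ≡ false → ∀ i → f i ≡ false
anyFin≡false {suc k} f any≡false i with f Fin.zero in f0≡b
anyFin≡false {suc k} f () i | true
anyFin≡false {suc k} f any≡false Fin.zero | false = f0≡b
anyFin≡false {suc k} f any≡false (Fin.suc i) | false = anyFin≡false (f ∘ Fin.suc) any≡false i

module Neighbourhood {n} (G : SimpleGraph n) where

  ∈N⁻ : ∀ (S : Subset n) {v} → v ∈ N G S → Σ (Fin n) λ u → u ∈ S × adj G u v ≡ true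
  ∈N⁻ S {v} v∈NS with anyFin⁻ _ (trans (sym (lookup∘tabulate _ v)) ([]=⇒lookup v∈NS))
  ... | u , eq with lookup S u in u∈S | eq
  ... | true | uv∈E = u , lookup⇒[]= u S u∈S , uv∈E

  ∈N⁺ : ∀ (S : Subset n) {u v} → u ∈ S → adj G u v ≡ true → v ∈ N G S
  ∈N⁺ S {u} {v} u∈S uv∈E with lookup (N G S) v in v∈NS
  ... | true = lookup⇒[]= v (N G S) v∈NS
  ... | false with lookup S u | []=⇒lookup u∈S | anyFin≡false _ (trans (sym (lookup∘tabulate _ v)) v∈NS) u
  ...   | true | refl | uv∉E with () ← trans (sym uv∈E) uv∉E

  closedN : Subset n → Subset n → Subset n
  closedN W S = (N G S ∩ W) ∪ S

  ⊆closedN : ∀ W S → S ⊆ closedN W S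
  ⊆closedN W S = SubsetP.q⊆p∪q (N G S ∩ W) S

  N∩⊆closedN : ∀ {W S x} → x ∈ N G S → x ∈ W → x ∈ closedN W S
  N∩⊆closedN x∈NS x∈W = SubsetP.x∈p∪q⁺ (inj₁ (SubsetP.x∈p∩q⁺ (x∈NS , x∈W)))

  closedN-⊆ : ∀ {W S} → S ⊆ W → closedN W S ⊆ W
  closedN-⊆ {W} {S} S⊆W = ∪-⊆ (SubsetP.p∩q⊆q (N G S) W) S⊆W

  ∉closedN⇒non-adjacent : ∀ {W S u v} → u ∈ S → v ∈ W → v ∉ closedN W S → adj G u v ≡ false
  ∉closedN⇒non-adjacent {W} {S} {u} {v} u∈S v∈W v∉N̄S with adj G u v in uv
  ... | false = refl
  ... | true = ⊥-elim (v∉N̄S (N∩⊆closedN (∈N⁺ S u∈S uv) v∈W))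

  closedN-∪ : ∀ W A S → closedN W (A ∪ S) ⊆ closedN W A ∪ closedN (W ─ A) S
  closedN-∪ W A S x∈N̄ = [ from-neighbour , from-member ]′ (SubsetP.x∈p∪q⁻ (N G (A ∪ S) ∩ W) (A ∪ S) x∈N̄)
    where
    inˡ : ∀ {x} → x ∈ closedN W A → x ∈ closedN W A ∪ closedN (W ─ A) S
    inˡ = SubsetP.x∈p∪q⁺ ∘ inj₁
    inʳ : ∀ {x} → x ∈ closedN (W ─ A) S → x ∈ closedN W A ∪ closedN (W ─ A) S
    inʳ = SubsetP.x∈p∪q⁺ ∘ inj₂
    from-member : ∀ {x} → x ∈ A ∪ S → x ∈ closedN W A ∪ closedN (W ─ A) S
    from-member x∈A∪S = SubsetP.x∈p∪q⁺ (Sum.map (⊆closedN W A) (⊆closedN (W ─ A) S) (SubsetP.x∈p∪q⁻ A S x∈A∪S))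
    from-neighbour : ∀ {x} → x ∈ N G (A ∪ S) ∩ W → x ∈ closedN W A ∪ closedN (W ─ A) S
    from-neighbour {x} x∈NW with SubsetP.x∈p∩q⁻ (N G (A ∪ S)) W x∈NW
    ... | x∈N , x∈W with ∈N⁻ (A ∪ S) x∈N
    ...   | u , u∈A∪S , ux with SubsetP.x∈p∪q⁻ A S u∈A∪S | x SubsetP.∈? A
    ...     | inj₁ u∈A | _      = inˡ (N∩⊆closedN (∈N⁺ A u∈A ux) x∈W)
    ...     | inj₂ _   | yes x∈A = inˡ (⊆closedN W A x∈A)
    ...     | inj₂ u∈S | no x∉A = inʳ (N∩⊆closedN (∈N⁺ S u∈S ux) (SubsetP.x∈p∧x∉q⇒x∈p─q x∈W x∉A))

  ∣closedN-∪∣≤ : ∀ W A S → ∣ closedN W (A ∪ S) ∣ ℕ.≤ ∣ closedN W A ∣ + ∣ N G S ∩ (W ─ A) ∣ + ∣ S ∣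
  ∣closedN-∪∣≤ W A S = begin
    ∣ closedN W (A ∪ S) ∣                          ≤⟨ SubsetP.p⊆q⇒∣p∣≤∣q∣ (closedN-∪ W A S) ⟩
    ∣ closedN W A ∪ closedN (W ─ A) S ∣             ≤⟨ ∣p∪q∣≤∣p∣+∣q∣ (closedN W A) _ ⟩
    ∣ closedN W A ∣ + ∣ closedN (W ─ A) S ∣         ≤⟨ ℕP.+-monoʳ-≤ ∣ closedN W A ∣ (∣p∪q∣≤∣p∣+∣q∣ NS S) ⟩
    ∣ closedN W A ∣ + (∣ NS ∣ + ∣ S ∣)               ≡⟨ ℕP.+-assoc (∣ closedN W A ∣) (∣ NS ∣) (∣ S ∣) ⟨
    ∣ closedN W A ∣ + ∣ NS ∣ + ∣ S ∣                 ∎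
    where
    NS : Subset n
    NS = N G S ∩ (W ─ A)
    open ℕP.≤-Reasoning

  closedN-⊥ : ∀ W → closedN W ⊥ ⊆ ⊥
  closedN-⊥ W x∈N̄ with SubsetP.x∈p∪q⁻ (N G ⊥ ∩ W) ⊥ x∈N̄
  ... | inj₂ x∈⊥ = x∈⊥
  ... | inj₁ x∈NW with ∈N⁻ ⊥ (proj₁ (SubsetP.x∈p∩q⁻ (N G ⊥) W x∈NW))
  ...   | _ , u∈⊥ , _ = ⊥-elim (SubsetP.∉⊥ u∈⊥)

module Copies {n} (G : SimpleGraph n) (m : ℕ) where

  HasK : Subset n → ℕ → Set
  HasK W k = CompContainsK G W m k

  IsCopy : Subset n → ∀ k → (Fin k → Fin m → Fin n) → Set
  IsCopy W k f =
    (∀ i j → f i j ∈ W) ×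
    (∀ i j i' j' → f i j ≡ f i' j' → (i ≡ i') × (j ≡ j')) ×
    (∀ i j i' j' → i ≢ i' → adj G (f i j) (f i' j') ≡ false)

  HasK-⊆ : ∀ {V W k} → V ⊆ W → HasK V k → HasK W k
  HasK-⊆ V⊆W (f , f∈V , f-inj , f-anti) = f , (λ i j → V⊆W (f∈V i j)) , f-inj , f-anti

  HasK-≤ : ∀ {W j k} → j ℕ.≤ k → HasK W k → HasK W j
  HasK-≤ j≤k (f , f∈W , f-inj , f-anti) =
    (λ i → f (inject≤ i j≤k)) , (λ i → f∈W _) ,
    (λ i j i' j' eq → let i≡i' , j≡j' = f-inj _ j _ j' eq in inject≤-injective i i' i≡i' , j≡j') ,
    (λ i j i' j' i≢i' → f-anti _ j _ j' (i≢i' ∘ inject≤-injective i i'))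
    where
    inject≤-injective : ∀ i i' → inject≤ i j≤k ≡ inject≤ i' j≤k → i ≡ i'
    inject≤-injective = FinP.inject≤-injective j≤k j≤k

  HasK-1 : ∀ {W} → m ℕ.≤ ∣ W ∣ → HasK W 1
  HasK-1 {W} m≤∣W∣ =
    let e , e∈W , e-inj = enumerate W in
    (λ _ j → e (inject≤ j m≤∣W∣)) , (λ _ _ → e∈W _) ,
    (λ { Fin.zero j Fin.zero j' eq → refl , FinP.inject≤-injective m≤∣W∣ m≤∣W∣ j j' (e-inj _ _ eq) }) ,
    (λ { Fin.zero _ Fin.zero _ 0≢0 → ⊥-elim (0≢0 refl) })

  HasK-∪ : ∀ {S B p r} → (∀ {x} → x ∈ S → x ∉ B) → (∀ {u v} → u ∈ S → v ∈ B → adj G u v ≡ false) →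
           HasK S p → HasK B r → HasK (S ∪ B) (p + r)
  HasK-∪ {S} {B} {p} {r} disjoint anticomplete (f , f∈S , f-inj , f-anti) (g , g∈B , g-inj , g-anti) =
    (λ i → F (splitAt p i)) , (λ i → F∈ (splitAt p i)) ,
    (λ i j i' j' eq → let i≡i' , j≡j' = F-inj (splitAt p i) j (splitAt p i') j' eq
                      in splitAt-injective i≡i' , j≡j') ,
    (λ i j i' j' i≢i' → F-anti (splitAt p i) j (splitAt p i') j' (i≢i' ∘ splitAt-injective))
    where
    splitAt-injective : ∀ {i i'} → splitAt p {r} i ≡ splitAt p i' → i ≡ i'
    splitAt-injective {i} {i'} eq =
      trans (sym (FinP.join-splitAt p r i)) (trans (cong (join p r) eq) (FinP.join-splitAt p r i'))
    F : Fin p ⊎ Fin r → Fin m → Fin n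
    F (inj₁ i) = f i
    F (inj₂ i) = g i
    F∈ : ∀ i j → F i j ∈ S ∪ B
    F∈ (inj₁ i) j = SubsetP.x∈p∪q⁺ (inj₁ (f∈S i j))
    F∈ (inj₂ i) j = SubsetP.x∈p∪q⁺ (inj₂ (g∈B i j))
    F-inj : ∀ i j i' j' → F i j ≡ F i' j' → (i ≡ i') × (j ≡ j')
    F-inj (inj₁ i) j (inj₁ i') j' eq = let i≡i' , j≡j' = f-inj i j i' j' eq in cong inj₁ i≡i' , j≡j'
    F-inj (inj₂ i) j (inj₂ i') j' eq = let i≡i' , j≡j' = g-inj i j i' j' eq in cong inj₂ i≡i' , j≡j'
    F-inj (inj₁ i) j (inj₂ i') j' eq = ⊥-elim (disjoint (f∈S i j) (subst (_∈ B) (sym eq) (g∈B i' j')))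
    F-inj (inj₂ i) j (inj₁ i') j' eq = ⊥-elim (disjoint (f∈S i' j') (subst (_∈ B) eq (g∈B i j)))
    F-anti : ∀ i j i' j' → i ≢ i' → adj G (F i j) (F i' j') ≡ false
    F-anti (inj₁ i) j (inj₁ i') j' i≢i' = f-anti i j i' j' (i≢i' ∘ cong inj₁)
    F-anti (inj₂ i) j (inj₂ i') j' i≢i' = g-anti i j i' j' (i≢i' ∘ cong inj₂)
    F-anti (inj₁ i) j (inj₂ i') j' _ = anticomplete (f∈S i j) (g∈B i' j')
    F-anti (inj₂ i) j (inj₁ i') j' _ = trans (adj-sym G _ _) (anticomplete (f∈S i' j') (g∈B i j))

  IsCopy? : ∀ W k f → Dec (IsCopy W k f)
  IsCopy? W k f =
    FinP.all? (λ i → FinP.all? λ j → f i j SubsetP.∈? W) ×-dec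
    (FinP.all? λ i → FinP.all? λ j → FinP.all? λ i' → FinP.all? λ j' →
       (f i j FinP.≟ f i' j') →-dec ((i FinP.≟ i') ×-dec (j FinP.≟ j'))) ×-dec
    (FinP.all? λ i → FinP.all? λ j → FinP.all? λ i' → FinP.all? λ j' →
       ¬? (i FinP.≟ i') →-dec (adj G (f i j) (f i' j') Bool.≟ false))

  IsCopy-resp : ∀ {W k} {f g : Fin k → Fin m → Fin n} → (∀ i j → f i j ≡ g i j) → IsCopy W k f → IsCopy W k g
  IsCopy-resp {W} f≗g (f∈W , f-inj , f-anti) =
    (λ i j → subst (_∈ W) (f≗g i j) (f∈W i j)) ,
    (λ i j i' j' eq → f-inj i j i' j' (trans (f≗g i j) (trans eq (sym (f≗g i' j'))))) ,
    (λ i j i' j' i≢i' → trans (sym (cong₂ (adj G) (f≗g i j) (f≗g i' j'))) (f-anti i j i' j' i≢i'))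

  HasK? : ∀ W k → Dec (HasK W k)
  HasK? W k = map′ (λ (v , copy) → table v , copy) fromCopy
    (Vec-searchable (Vec-searchable FinP.any? m) k (λ v → IsCopy? W k (table v)))
    where
    table : Vec (Vec (Fin n) m) k → Fin k → Fin m → Fin n
    table v i j = lookup (lookup v i) j
    fromCopy : HasK W k → Σ (Vec (Vec (Fin n) m) k) λ v → IsCopy W k (table v)
    fromCopy (f , copy) = tabulate (tabulate ∘ f) , IsCopy-resp (λ i j → sym (trans
      (cong (λ row → lookup row j) (lookup∘tabulate (tabulate ∘ f) i)) (lookup∘tabulate (f i) j))) copy

  IsThreshold : Subset n → ℕ → Set
  IsThreshold S j = 1 ℕ.≤ j × HasK S j × ¬ HasK S (suc j)

  ∃-threshold : ∀ {S a} → 1 ℕ.≤ a → m ℕ.≤ ∣ S ∣ → ¬ HasK S a → ∃ (IsThreshold S)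
  ∃-threshold {S} {a} 1≤a m≤∣S∣ ¬HasKa =
    ∃-boundary (HasK? S) 1 (a ℕ.∸ 1) (HasK-1 m≤∣S∣) (¬HasKa ∘ subst (HasK S) (ℕP.m+[n∸m]≡n 1≤a))

module Construction (β M Δ : ℚ) (m : ℕ) (1≤β : 1ℚ ℚ.≤ β) (1≤M : 1ℚ ℚ.≤ M) (1≤Δ : 1ℚ ℚ.≤ Δ) (1≤m : 1 ℕ.≤ m)
                    (β+2<M/4 : β ℚ.+ ℕ→ℚ 2 ℚ.< M ℚ.* ((+ 1) / 4)) (3Δ<β : ℕ→ℚ 3 ℚ.* Δ ℚ.< β)
                    {n} (G : SimpleGraph n) where

  open Neighbourhood G
  open Copies G m
  open Bounds β M m 1≤β 1≤M β+2<M/4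

  private
    m̂ : ℚ
    m̂ = ℕ→ℚ m
    0≤Δ : 0ℚ ℚ.≤ Δ
    0≤Δ = ℚP.≤-trans (0≤ℕ→ℚ 1) 1≤Δ

  Conclusion : Set
  Conclusion = Σ ℕ λ k' → Σ (Subset n) λ W →
    ¬ HasK W k' × L k' ℚ.- m̂ ℚ.≤ ℕ→ℚ ∣ W ∣ × ℕ→ℚ ∣ W ∣ ℚ.≤ L k' × m ℕ.≤ ∣ W ∣ × ExpandsInto G W Δ β m

  Bottleneck : Subset n → Subset n → Set
  Bottleneck W S = S ⊆ W × m ℕ.≤ ∣ S ∣ × 2 ℕ.* ∣ S ∣ ℕ.≤ ∣ W ∣ ×
                   ℕ→ℚ ∣ closedN W S ∣ ℚ.< ℕ→ℚ ∣ S ∣ ℚ.+ β ℚ.* m̂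

  Contracting : Subset n → Subset n → Set
  Contracting W S = S ⊆ W × ∣ S ∣ ℕ.< m × ℕ→ℚ ∣ N G S ∩ W ∣ ℚ.< Δ ℚ.* ℕ→ℚ ∣ S ∣

  Bottleneck? : ∀ W → Decidable (Bottleneck W)
  Bottleneck? W S = (S SubsetP.⊆? W) ×-dec (m ℕP.≤? ∣ S ∣) ×-dec (2 ℕ.* ∣ S ∣ ℕP.≤? ∣ W ∣) ×-dec
                    (ℕ→ℚ ∣ closedN W S ∣ ℚP.<? ℕ→ℚ ∣ S ∣ ℚ.+ β ℚ.* m̂)

  Contracting? : ∀ W → Decidable (Contracting W)
  Contracting? W S = (S SubsetP.⊆? W) ×-dec (∣ S ∣ ℕP.<? m) ×-dec (ℕ→ℚ ∣ N G S ∩ W ∣ ℚP.<? Δ ℚ.* ℕ→ℚ ∣ S ∣)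


  expands-of-no-violation : ∀ W → ¬ ∃ (Bottleneck W) → ¬ ∃ (Contracting W) → ExpandsInto G W Δ β m
  expands-of-no-violation W ¬bottleneck ¬contracting =
    (λ S S⊆W ∣S∣<m → ℚP.≮⇒≥ λ lt → ¬contracting (S , S⊆W , ∣S∣<m , lt)) ,
    (λ S S⊆W m≤∣S∣ 2∣S∣≤∣W∣ → ℚP.≮⇒≥ λ lt → ¬bottleneck (S , S⊆W , m≤∣S∣ , 2∣S∣≤∣W∣ , lt))

  expands-or-violated : ∀ W → ExpandsInto G W Δ β m ⊎ (∃ (Bottleneck W) ⊎ ∃ (Contracting W))
  expands-or-violated W = decide (SubsetP.anySubset? (Bottleneck? W)) (SubsetP.anySubset? (Contracting? W))
    where
    decide : Dec (∃ (Bottleneck W)) → Dec (∃ (Contracting W)) →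
             ExpandsInto G W Δ β m ⊎ (∃ (Bottleneck W) ⊎ ∃ (Contracting W))
    decide (yes bottleneck) _ = inj₂ (inj₁ bottleneck)
    decide (no _) (yes contracting) = inj₂ (inj₂ contracting)
    decide (no ¬bottleneck) (no ¬contracting) = inj₁ (expands-of-no-violation W ¬bottleneck ¬contracting)

  contracting-nonempty : ∀ {W S} → Contracting W S → 1 ℕ.≤ ∣ S ∣
  contracting-nonempty {W} {S} (_ , _ , N<Δ∣S∣) = ℕP.n≢0⇒n>0 λ ∣S∣≡0 →
    ℚP.<-irrefl refl (ℚP.≤-<-trans (0≤ℕ→ℚ ∣ N G S ∩ W ∣)
      (subst (ℕ→ℚ ∣ N G S ∩ W ∣ ℚ.<_) (trans (cong (λ s → Δ ℚ.* ℕ→ℚ s) ∣S∣≡0) (ℚP.*-zeroʳ Δ)) N<Δ∣S∣))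

  Admissible : ℕ → Subset n → Set
  Admissible a X = ¬ HasK X a × L a ℚ.≤ ℕ→ℚ ∣ X ∣

  SmallerAdmissible : ℕ → Set
  SmallerAdmissible a = Σ ℕ λ a' → a' ℕ.< a × 2 ℕ.≤ a' × Σ (Subset n) (Admissible a')

  split-anticomplete : ∀ {a W S B} → 2 ℕ.≤ a → ¬ HasK W a → S ⊆ W → B ⊆ W →
              (∀ {x} → x ∈ S → x ∉ B) → (∀ {u v} → u ∈ S → v ∈ B → adj G u v ≡ false) →
              m ℕ.≤ ∣ S ∣ → m ℕ.≤ ∣ B ∣ →
              (∀ {a₁ a₂} → a₁ + a₂ ℕ.≤ a + 1 → L a₁ ℚ.≤ ℕ→ℚ ∣ S ∣ ⊎ L a₂ ℚ.≤ ℕ→ℚ ∣ B ∣) → SmallerAdmissible a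
  split-anticomplete {a} {W} {S} {B} 2≤a ¬HasKW S⊆W B⊆W disjoint anticomplete m≤∣S∣ m≤∣B∣ one-side-large =
    choose (∃-threshold (ℕP.<⇒≤ 2≤a) m≤∣S∣ (¬HasKW ∘ HasK-⊆ S⊆W))
           (∃-threshold (ℕP.<⇒≤ 2≤a) m≤∣B∣ (¬HasKW ∘ HasK-⊆ B⊆W))
    where
    choose : ∃ (IsThreshold S) → ∃ (IsThreshold B) → SmallerAdmissible a
    choose (j₁ , 1≤j₁ , HasKSj₁ , ¬HasKSj₁+1) (j₂ , 1≤j₂ , HasKBj₂ , ¬HasKBj₂+1) =
      side (one-side-large {suc j₁} {suc j₂} sum≤a+1)
      where
      j₁+j₂<a : j₁ + j₂ ℕ.< a
      j₁+j₂<a = ℕP.≰⇒> λ a≤j₁+j₂ →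
        ¬HasKW (HasK-⊆ (∪-⊆ S⊆W B⊆W) (HasK-≤ a≤j₁+j₂ (HasK-∪ disjoint anticomplete HasKSj₁ HasKBj₂)))
      sum≤a+1 : suc j₁ + suc j₂ ℕ.≤ a + 1
      sum≤a+1 = subst₂ ℕ._≤_ (cong suc (sym (ℕP.+-suc j₁ j₂))) (ℕP.+-comm 1 a) (s≤s j₁+j₂<a)
      side : L (suc j₁) ℚ.≤ ℕ→ℚ ∣ S ∣ ⊎ L (suc j₂) ℚ.≤ ℕ→ℚ ∣ B ∣ → SmallerAdmissible a
      side (inj₁ L≤∣S∣) = suc j₁ , ℕP.≤-<-trans (subst (ℕ._≤ j₁ + j₂) (ℕP.+-comm j₁ 1) (ℕP.+-monoʳ-≤ j₁ 1≤j₂))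
                                                 j₁+j₂<a ,
                          s≤s 1≤j₁ , S , ¬HasKSj₁+1 , L≤∣S∣
      side (inj₂ L≤∣B∣) = suc j₂ , ℕP.≤-<-trans (ℕP.+-monoˡ-≤ j₂ 1≤j₁) j₁+j₂<a , s≤s 1≤j₂ , B , ¬HasKBj₂+1 , L≤∣B∣

  split-at-bottleneck : ∀ {a W S} → 2 ℕ.≤ a → ¬ HasK W a → L a ℚ.< ℕ→ℚ ∣ W ∣ ℚ.+ m̂ → Bottleneck W S →
                        SmallerAdmissible a
  split-at-bottleneck {a} {W} {S} 2≤a ¬HasKW La<W+m (S⊆W , m≤∣S∣ , 2∣S∣≤∣W∣ , N̄<S+βm) =
    split-anticomplete 2≤a ¬HasKW S⊆W (SubsetP.p─q⊆p W N̄) (λ x∈S x∈B → x∈p─q⇒x∉q x∈B (⊆closedN W S x∈S))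
      (λ u∈S v∈B → ∉closedN⇒non-adjacent u∈S (SubsetP.p─q⊆p W N̄ v∈B) (x∈p─q⇒x∉q v∈B))
      m≤∣S∣ m≤∣B∣ (λ {a₁} {a₂} sum≤ → L-split {a} {a₁} {a₂} sum≤ La<B+N̄+m N̄<S+βm)
    where
    N̄ B : Subset n
    N̄ = closedN W S
    B = W ─ N̄
    ∣W∣≡ : ℕ→ℚ ∣ W ∣ ≡ ℕ→ℚ ∣ B ∣ ℚ.+ ℕ→ℚ ∣ N̄ ∣
    ∣W∣≡ = trans (cong ℕ→ℚ (sym (∣p─q∣+∣q∣≡∣p∣ (closedN-⊆ S⊆W)))) (ℕ→ℚ-+ ∣ B ∣ ∣ N̄ ∣)
    La<B+N̄+m : L a ℚ.< (ℕ→ℚ ∣ B ∣ ℚ.+ ℕ→ℚ ∣ N̄ ∣) ℚ.+ m̂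
    La<B+N̄+m = subst (λ w → L a ℚ.< w ℚ.+ m̂) ∣W∣≡ La<W+m
    m≤∣B∣ : m ℕ.≤ ∣ B ∣
    m≤∣B∣ = ℕP.<⇒≤ (ℕ→ℚ-cancel-< (bottleneck-complement-large {a} {ℕ→ℚ ∣ S ∣} {ℕ→ℚ ∣ B ∣} {ℕ→ℚ ∣ N̄ ∣}
      2≤a La<B+N̄+m (subst₂ ℚ._≤_ (ℕ→ℚ-* 2 ∣ S ∣) ∣W∣≡ (ℕ→ℚ-mono-≤ 2∣S∣≤∣W∣)) N̄<S+βm))

  module Peeling {a c} {W₀ : Subset n} (2≤a : 2 ℕ.≤ a) (¬HasKW₀ : ¬ HasK W₀ a) (∣W₀∣≡c : ∣ W₀ ∣ ≡ c)
                 (c≤La : ℕ→ℚ c ℚ.≤ L a) (La<c+1 : L a ℚ.< ℕ→ℚ (suc c)) where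

    La<size+m : ∀ {w} → c ℕ.< w + m → L a ℚ.< ℕ→ℚ w ℚ.+ m̂
    La<size+m {w} c<w+m = ℚP.<-≤-trans La<c+1 (subst (ℕ→ℚ (suc c) ℚ.≤_) (ℕ→ℚ-+ w m) (ℕ→ℚ-mono-≤ c<w+m))

    W₀-large : L a ℚ.< ℕ→ℚ ∣ W₀ ∣ ℚ.+ m̂
    W₀-large = La<size+m (subst (ℕ._< ∣ W₀ ∣ + m) ∣W₀∣≡c (ℕP.m<m+n ∣ W₀ ∣ 1≤m))

    -- Absorbing a contracting S ⊆ W₀ ∖ A adds fewer than Δ|S| vertices to N_{W₀}(A) ∪ A,
    -- so the peeled set A keeps expanding by less than Δ inside W₀.
    record Removable (A : Subset n) : Set where
      field
        A⊆W₀        : A ⊆ W₀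
        ∣A∣<m       : ∣ A ∣ ℕ.< m
        slow-growth : ℕ→ℚ ∣ closedN W₀ A ∣ ℚ.≤ ℕ→ℚ ∣ A ∣ ℚ.+ Δ ℚ.* ℕ→ℚ ∣ A ∣

    removable-⊥ : Removable ⊥
    removable-⊥ = record
      { A⊆W₀        = SubsetP.⊥⊆
      ; ∣A∣<m       = subst (ℕ._< m) (sym (SubsetP.∣⊥∣≡0 n)) 1≤m
      ; slow-growth = ℚP.≤-trans (ℕ→ℚ-mono-≤ (SubsetP.p⊆q⇒∣p∣≤∣q∣ (closedN-⊥ W₀)))
                                 (≤-via (0≤* 0≤Δ (0≤ℕ→ℚ ∣ ⊥ {n} ∣)) refl)
      }

    module _ {A} (removable : Removable A) where
      open Removable removable

      ∣W₀─A∣+∣A∣≡c : ∣ W₀ ─ A ∣ + ∣ A ∣ ≡ c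
      ∣W₀─A∣+∣A∣≡c = trans (∣p─q∣+∣q∣≡∣p∣ A⊆W₀) ∣W₀∣≡c

      remainder-free : ¬ HasK (W₀ ─ A) a
      remainder-free = ¬HasKW₀ ∘ HasK-⊆ (SubsetP.p─q⊆p W₀ A)

      remainder-large : L a ℚ.< ℕ→ℚ ∣ W₀ ─ A ∣ ℚ.+ m̂
      remainder-large = La<size+m (subst (ℕ._< ∣ W₀ ─ A ∣ + m) ∣W₀─A∣+∣A∣≡c (ℕP.+-monoʳ-< ∣ W₀ ─ A ∣ ∣A∣<m))

      finish : ExpandsInto G (W₀ ─ A) Δ β m → Conclusion
      finish expands = a , W₀ ─ A , remainder-free , x<y+z⇒x-z≤y remainder-large ,
        ℚP.≤-trans (ℕ→ℚ-mono-≤ (subst (∣ W₀ ─ A ∣ ℕ.≤_) ∣W₀─A∣+∣A∣≡c (ℕP.m≤m+n _ _))) c≤La ,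
        ℕP.<⇒≤ (ℕ→ℚ-cancel-< (L<w+m⇒m<w {a} 2≤a remainder-large)) , expands

      ∣A∪S∣≡∣A∣+∣S∣ : ∀ {S} → Contracting (W₀ ─ A) S → ∣ A ∪ S ∣ ≡ ∣ A ∣ + ∣ S ∣
      ∣A∪S∣≡∣A∣+∣S∣ {S} (S⊆W , _) = ∣p∪q∣≡∣p∣+∣q∣ A S (λ x∈A x∈S → x∈p─q⇒x∉q (S⊆W x∈S) x∈A)

      absorb : ∀ {S} → Contracting (W₀ ─ A) S → Removable (A ∪ S) ⊎ SmallerAdmissible a
      absorb {S} contracting@(S⊆W , ∣S∣<m , NS<Δ∣S∣) = decide (∣ A ∪ S ∣ ℕP.<? m)
        where
        ℕ→ℚ∣A∪S∣≡ : ℕ→ℚ ∣ A ∪ S ∣ ≡ ℕ→ℚ ∣ A ∣ ℚ.+ ℕ→ℚ ∣ S ∣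
        ℕ→ℚ∣A∪S∣≡ = trans (cong ℕ→ℚ (∣A∪S∣≡∣A∣+∣S∣ contracting)) (ℕ→ℚ-+ ∣ A ∣ ∣ S ∣)
        A∪S⊆W₀ : A ∪ S ⊆ W₀
        A∪S⊆W₀ = ∪-⊆ A⊆W₀ (SubsetP.p─q⊆p W₀ A ∘ S⊆W)
        NS∖A : Subset n
        NS∖A = N G S ∩ (W₀ ─ A)
        ∣N̄[A∪S]∣≤ : ℕ→ℚ ∣ closedN W₀ (A ∪ S) ∣ ℚ.≤ ℕ→ℚ ∣ closedN W₀ A ∣ ℚ.+ ℕ→ℚ ∣ NS∖A ∣ ℚ.+ ℕ→ℚ ∣ S ∣
        ∣N̄[A∪S]∣≤ = subst (ℕ→ℚ ∣ closedN W₀ (A ∪ S) ∣ ℚ.≤_)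
          (trans (ℕ→ℚ-+ (∣ closedN W₀ A ∣ + ∣ NS∖A ∣) ∣ S ∣)
                 (cong (ℚ._+ ℕ→ℚ ∣ S ∣) (ℕ→ℚ-+ ∣ closedN W₀ A ∣ ∣ NS∖A ∣)))
          (ℕ→ℚ-mono-≤ (∣closedN-∪∣≤ W₀ A S))
        growth : ℕ→ℚ ∣ closedN W₀ (A ∪ S) ∣ ℚ.< ℕ→ℚ ∣ A ∪ S ∣ ℚ.+ Δ ℚ.* ℕ→ℚ ∣ A ∪ S ∣
        growth = subst (λ s → ℕ→ℚ ∣ closedN W₀ (A ∪ S) ∣ ℚ.< s ℚ.+ Δ ℚ.* s) (sym ℕ→ℚ∣A∪S∣≡)
          (expansion-accumulates Δ {ℕ→ℚ ∣ A ∣} {ℕ→ℚ ∣ S ∣} ∣N̄[A∪S]∣≤ slow-growth NS<Δ∣S∣)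
        ∣A∪S∣≤2m : ∣ A ∪ S ∣ ℕ.≤ m + m
        ∣A∪S∣≤2m = subst (ℕ._≤ m + m) (sym (∣A∪S∣≡∣A∣+∣S∣ contracting)) (ℕP.+-mono-≤ (ℕP.<⇒≤ ∣A∣<m) (ℕP.<⇒≤ ∣S∣<m))
        2∣A∪S∣≤∣W₀∣ : 2 ℕ.* ∣ A ∪ S ∣ ℕ.≤ ∣ W₀ ∣
        2∣A∪S∣≤∣W₀∣ = ℕP.≤-trans (ℕP.*-monoʳ-≤ 2 ∣A∪S∣≤2m)
          (subst (2 ℕ.* (m + m) ℕ.≤_) (sym ∣W₀∣≡c) (ℕP.≤-pred (L<c⇒2[m+m]<c {a} 2≤a La<c+1)))
        decide : Dec (∣ A ∪ S ∣ ℕ.< m) → Removable (A ∪ S) ⊎ SmallerAdmissible a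
        decide (yes ∣A∪S∣<m) = inj₁ (record { A⊆W₀ = A∪S⊆W₀ ; ∣A∣<m = ∣A∪S∣<m ; slow-growth = ℚP.<⇒≤ growth })
        decide (no ∣A∪S∣≮m) = inj₂ (split-at-bottleneck 2≤a ¬HasKW₀ W₀-large
          (A∪S⊆W₀ , ℕP.≮⇒≥ ∣A∪S∣≮m , 2∣A∪S∣≤∣W₀∣ ,
           expansion-within-margin 0≤Δ (0≤ℕ→ℚ m) 3Δ<β
             (subst (_ ℚ.≤_) (ℕ→ℚ-+ m m) (ℕ→ℚ-mono-≤ ∣A∪S∣≤2m)) growth))

    peel : ∀ fuel A → m ℕ.≤ ∣ A ∣ + fuel → Removable A → Conclusion ⊎ SmallerAdmissible a
    peel zero A m≤∣A∣+0 removable =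
      ⊥-elim (ℕP.<⇒≱ (Removable.∣A∣<m removable) (subst (m ℕ.≤_) (ℕP.+-identityʳ ∣ A ∣) m≤∣A∣+0))
    peel (suc fuel) A m≤∣A∣+fuel+1 removable =
      [ inj₁ ∘ finish removable
      , [ inj₂ ∘ split-at-bottleneck 2≤a (remainder-free removable) (remainder-large removable) ∘ proj₂ , grow ]′
      ]′ (expands-or-violated (W₀ ─ A))
      where
      grow : ∃ (Contracting (W₀ ─ A)) → Conclusion ⊎ SmallerAdmissible a
      grow (S , contracting) = [ peel fuel (A ∪ S) m≤∣A∪S∣+fuel , inj₂ ]′ (absorb removable contracting)
        where
        m≤∣A∪S∣+fuel : m ℕ.≤ ∣ A ∪ S ∣ + fuel
        m≤∣A∪S∣+fuel = begin
          m                      ≤⟨ m≤∣A∣+fuel+1 ⟩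
          ∣ A ∣ + suc fuel       ≡⟨ ℕP.+-suc ∣ A ∣ fuel ⟩
          suc (∣ A ∣ + fuel)     ≤⟨ ℕP.+-monoˡ-≤ fuel (ℕP.m<m+n ∣ A ∣ (contracting-nonempty contracting)) ⟩
          ∣ A ∣ + ∣ S ∣ + fuel   ≡⟨ cong (_+ fuel) (∣A∪S∣≡∣A∣+∣S∣ removable contracting) ⟨
          ∣ A ∪ S ∣ + fuel       ∎
          where open ℕP.≤-Reasoning

    peel-from-⊥ : Conclusion ⊎ SmallerAdmissible a
    peel-from-⊥ = peel m ⊥ (ℕP.m≤n+m m ∣ ⊥ {n} ∣) removable-⊥

  conclude-or-descend : ∀ {a X} → 2 ℕ.≤ a → Admissible a X → Conclusion ⊎ SmallerAdmissible a
  conclude-or-descend {a} {X} 2≤a (¬HasKX , La≤∣X∣) =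
    let c , c≤∣X∣ , c≤La , La<c+1 = ∃-floor ∣ X ∣ (0≤L {a} 2≤a) La≤∣X∣
        W₀ , W₀⊆X , ∣W₀∣≡c = ∃-⊆-of-size X c c≤∣X∣
    in Peeling.peel-from-⊥ 2≤a (¬HasKX ∘ HasK-⊆ W₀⊆X) ∣W₀∣≡c c≤La La<c+1

  admissible⇒conclusion : ∀ a → 2 ℕ.≤ a → ∀ X → Admissible a X → Conclusion
  admissible⇒conclusion = <-rec (λ a → 2 ℕ.≤ a → ∀ X → Admissible a X → Conclusion)
    λ a descend 2≤a X admissible →
      [ id , (λ (a' , a'<a , 2≤a' , X' , admissible') → descend a'<a 2≤a' X' admissible') ]′
        (conclude-or-descend 2≤a admissible)

lemma2p5 : (β M Δ : ℚ) (m k : ℕ) →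
    1ℚ ℚ.≤ β → 1ℚ ℚ.≤ M → 1ℚ ℚ.≤ Δ → 1 ℕ.≤ m → 1 ℕ.≤ k →
    β ℚ.+ ℕ→ℚ 2 ℚ.< M ℚ.* ((+ 1) / 4) →
    ℕ→ℚ 3 ℚ.* Δ ℚ.< β →
    ∀ {n} (G : SimpleGraph n) →
    ¬ CompContainsK G ⊤ m k →
    m ℕ.≤ n →
    M ℚ.* (ℕ→ℚ k ℚ.- (+ 3) / 2) ℚ.* ℕ→ℚ m ℚ.≤ ℕ→ℚ n →
    Σ ℕ λ k' → Σ (Subset n) λ W →
      ¬ CompContainsK G W m k' ×
      M ℚ.* (ℕ→ℚ k' ℚ.- (+ 3) / 2) ℚ.* ℕ→ℚ m ℚ.- ℕ→ℚ m ℚ.≤ ℕ→ℚ ∣ W ∣ ×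
      ℕ→ℚ ∣ W ∣ ℚ.≤ M ℚ.* (ℕ→ℚ k' ℚ.- (+ 3) / 2) ℚ.* ℕ→ℚ m ×
      m ℕ.≤ ∣ W ∣ ×
      ExpandsInto G W Δ β m
lemma2p5 β M Δ m k 1≤β 1≤M 1≤Δ 1≤m _ β+2<M/4 3Δ<β {n} G ¬HasK⊤ m≤n Lk≤n =
  admissible⇒conclusion k 2≤k ⊤ (¬HasK⊤ , subst (λ size → L k ℚ.≤ ℕ→ℚ size) (sym (SubsetP.∣⊤∣≡n n)) Lk≤n)
  where
  open Copies G m
  open Bounds β M m 1≤β 1≤M β+2<M/4 using (L)
  open Construction β M Δ m 1≤β 1≤M 1≤Δ 1≤m β+2<M/4 3Δ<β G
  2≤k : 2 ℕ.≤ k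
  2≤k = ℕP.≰⇒> λ k≤1 → ¬HasK⊤ (HasK-≤ k≤1 (HasK-1 (subst (m ℕ.≤_) (sym (SubsetP.∣⊤∣≡n n)) m≤n)))
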